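{- Let $(G',k')$ be the instance output by the kernelization for Diamond-free Edge Deletion (resp. for $\{$Diamond, $K_t\}$-free Edge Deletion, $t\ge 4$ fixed) on input $(G,k)$, and let $X$, $V_X$, $\mathcal{C}$ be as described in the context. Let $\mathcal{C}_1$ be the set of members of $\mathcal{C}$ with exactly one vertex. Then $\sum_{C\in\mathcal{C}_1}|C|=O(k^2)$.
   Context: A diamond is $K_4$ minus an edge. The problems ask, for $(G,k)$, whether some $F\subseteq E(G)$, $|F|\le k$, makes $G-F$ free of induced diamonds (and, in the second version, of $K_t$). Phase 1: exhaustively apply (Irrelevant edge) delete an edge not contained in any subgraph isomorphic to a forbidden graph; (Sunflower) if $\{x,y\}\in E(G)$ and $G[N(x)\cap N(y)]$ has $k+1$ pairwise vertex-disjoint non-edges, delete $\{x,y\}$ and decrease $k$ by 1; (Vertex-split) if $G[N(v)]$ has components $V_1,\dots,V_t$, $t>1$, replace $v$ by new vertices $v_1,\dots,v_t$ with $N(v_i)=V_i$; (Irrelevant component) delete a connected component with no induced forbidden graph. Greedy packing: starting with $X=\emptyset$, repeatedly add the edges of an induced forbidden graph (diamond; resp. diamond or $K_t$) of $(V(G),E(G)\setminus X)$ to $X$ until none exists; $V_X$ is the set of endpoints of $X$; $\mathcal{C}$ is the set of vertex sets of maximal cliques of $G-V_X$. Kernelization for Diamond-free Edge Deletion: apply Phase 1; greedily pack; if more than $k'$ diamonds are packed declare no-instance, else compute $X,V_X,\mathcal{C}$ and exhaustively apply the clique reduction rule (for $C\in\mathcal{C}$ with $|C|\ge3$, $|C|>4k'$: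 with $A_C$ the vertices of $V_X$ adjacent to all of $C$ and $C''=\{v\in C: N(v)\subseteq C\cup A_C\}$, delete any $|C''|-1$ vertices of $C''$); here $X,V_X,\mathcal{C}$ are taken as they stand after the last application of clique reduction. Kernelization for $\{$Diamond, $K_t\}$-free Edge Deletion: apply Phase 1 and greedily pack diamonds and $K_t$'s; declare no-instance if more than $k'$ are packed, else output the Phase 1 result, with $X,V_X,\mathcal{C}$ from the packing. -}

module Defs where

open import Data.Nat using (ℕ; zero; suc; _+_; _*_; _≤_; _<_)
open import Data.Fin using (Fin)
open import Data.Product using (Σ; ∃; _×_; _,_; ∃-syntax)
open import Data.Sum using (_⊎_)
open import Data.Unit using (⊤)
open import Data.List using (List; []; _∷_; length)
open import Data.List.Relation.Unary.Any using (Any)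
open import Relation.Nullary using (¬_)
open import Relation.Binary.PropositionalEquality using (_≡_; _≢_)

record Graph : Set₁ where
  field
    n      : ℕ
    E      : Fin n → Fin n → Set
    sym    : ∀ {u v} → E u v → E v u
    irrefl : ∀ {u} → ¬ E u u
open Graph public

Rel : ℕ → Set₁
Rel n = Fin n → Fin n → Set

InjectiveFn : ∀ {m n} → (Fin m → Fin n) → Set
InjectiveFn f = ∀ i j → f i ≡ f j → i ≡ j

AtLeast : ∀ {n} → ℕ → (Fin n → Set) → Set
AtLeast {n} m C = Σ (Fin m → Fin n) λ g → InjectiveFn g × (∀ i → C (g i))

-- unordered pair {u,v} = {x,y}
UEq : ∀ {n} → Fin n → Fin n → Fin n → Fin n → Set
UEq u v x y = (u ≡ x × v ≡ y) ⊎ (u ≡ y × v ≡ x)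

data Problem : Set where
  diamondFree  : Problem
  diamondKFree : ℕ → Problem

ValidProblem : Problem → Set
ValidProblem diamondFree      = ⊤
ValidProblem (diamondKFree t) = 4 ≤ t

-- an occurrence of a forbidden graph: a diamond on (a,b,c,d) with
-- edges ab ac ad bc bd (cd the missing edge), or (only for the second
-- problem) a K_t given by an injective map Fin t → Fin n
data Occ : Problem → ℕ → Set where
  dia : ∀ {P n} → (a b c d : Fin n) → Occ P n
  kt  : ∀ {t n} → (Fin t → Fin n) → Occ (diamondKFree t) n

Distinct4 : ∀ {n} → Fin n → Fin n → Fin n → Fin n → Set
Distinct4 a b c d = a ≢ b × a ≢ c × a ≢ d × b ≢ c × b ≢ d × c ≢ d

InducedOcc : ∀ {P n} → Rel n → Occ P n → Set
InducedOcc A (dia a b c d) =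
  Distinct4 a b c d × A a b × A a c × A a d × A b c × A b d × ¬ A c d
InducedOcc A (kt f) = InjectiveFn f × (∀ i j → i ≢ j → A (f i) (f j))

SubOcc : ∀ {P n} → Rel n → Occ P n → Set
SubOcc A (dia a b c d) =
  Distinct4 a b c d × A a b × A a c × A a d × A b c × A b d
SubOcc A (kt f) = InjectiveFn f × (∀ i j → i ≢ j → A (f i) (f j))

OccEdge : ∀ {P n} → Occ P n → Fin n → Fin n → Set
OccEdge (dia a b c d) u v =
  UEq u v a b ⊎ UEq u v a c ⊎ UEq u v a d ⊎ UEq u v b c ⊎ UEq u v b d
OccEdge (kt f) u v = ∃[ i ] ∃[ j ] (i ≢ j × f i ≡ u × f j ≡ v)

OccVert : ∀ {P n} → Occ P n → Fin n → Set
OccVert (dia a b c d) v = v ≡ a ⊎ v ≡ b ⊎ v ≡ c ⊎ v ≡ d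
OccVert (kt f) v = ∃[ i ] f i ≡ v

data Reach {n} (A : Rel n) (D : Fin n → Set) : Fin n → Fin n → Set where
  here : ∀ {u} → D u → Reach A D u u
  step : ∀ {u v w} → D u → A u v → Reach A D v w → Reach A D u w

deleteEdge : (G : Graph) → Fin (n G) → Fin (n G) → Graph
deleteEdge G x y = record
  { n      = n G
  ; E      = λ u v → E G u v × ¬ UEq u v x y
  ; sym    = λ { (e , ne) → sym G e , λ { (_⊎_.inj₁ (p , q)) → ne (_⊎_.inj₂ (q , p))
                                         ; (_⊎_.inj₂ (p , q)) → ne (_⊎_.inj₁ (q , p)) } }
  ; irrefl = λ { (e , _) → irrefl G e }
  }

-- H is (an isomorphic copy of) the induced subgraph G[S], via the
-- embedding f : V(H) → V(G)
InducedVia : (G : Graph) → (Fin (n G) → Set) → (H : Graph) → (Fin (n H) → Fin (n G)) → Set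
InducedVia G S H f =
  InjectiveFn f × (∀ i → S (f i)) × (∀ v → S v → ∃[ i ] f i ≡ v) ×
  (∀ i j → E H i j → E G (f i) (f j)) × (∀ i j → E G (f i) (f j) → E H i j)

-- Sunflower condition at budget K: G[N(x) ∩ N(y)] has K+1 pairwise
-- vertex-disjoint non-edges {p i, q i}
Sunflower : (G : Graph) → Fin (n G) → Fin (n G) → ℕ → Set
Sunflower G x y K =
  Σ (Fin (suc K) → Fin (n G)) λ p → Σ (Fin (suc K) → Fin (n G)) λ q →
    (∀ i → E G x (p i) × E G y (p i) × E G x (q i) × E G y (q i)) ×
    (∀ i → p i ≢ q i × ¬ E G (p i) (q i)) ×
    InjectiveFn p × InjectiveFn q × (∀ i j → p i ≢ q j)

-- H arises from G by splitting v according to the components of G[N(v)];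
-- π maps each vertex of H to the vertex of G it comes from (the copies
-- v_1..v_t are exactly the preimages of v).
VertexSplit : (G : Graph) → (H : Graph) → (Fin (n H) → Fin (n G)) → Fin (n G) → Set
VertexSplit G H π v =
  (∀ u → u ≢ v → ∃[ w ] π w ≡ u) ×
  (∀ w w' → π w ≡ π w' → π w ≢ v → w ≡ w') ×
  (∀ w w' → π w ≢ v → π w' ≢ v → E H w w' → E G (π w) (π w')) ×
  (∀ w w' → π w ≢ v → π w' ≢ v → E G (π w) (π w') → E H w w') ×
  (∀ w w' → π w ≡ v → π w' ≡ v → ¬ E H w w') ×
  -- the neighbourhood of each copy is a connected component V_i of G[N(v)]
  (∀ w → π w ≡ v →
     (∀ w' → E H w w' → E G v (π w')) ×
     (∃[ w' ] E H w w') ×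
     (∀ w₁ w₂ → E H w w₁ → E H w w₂ → Reach (E G) (E G v) (π w₁) (π w₂)) ×
     (∀ w₁ a → E H w w₁ → Reach (E G) (E G v) (π w₁) a → ∃[ w₂ ] (π w₂ ≡ a × E H w w₂))) ×
  (∀ w₁ w₂ w' → π w₁ ≡ v → π w₂ ≡ v → E H w₁ w' → E H w₂ w' → w₁ ≡ w₂) ×
  (∀ a → E G v a → ∃[ w ] ∃[ w' ] (π w ≡ v × π w' ≡ a × E H w w')) ×
  (∃[ w₁ ] ∃[ w₂ ] (π w₁ ≡ v × π w₂ ≡ v × w₁ ≢ w₂))

IrrelevantComponent : Problem → (G : Graph) → (Fin (n G) → Set) → Set
IrrelevantComponent P G D =
  (∃[ v ] D v) ×
  (∀ u v → D u → E G u v → D v) ×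
  (∀ u v → D u → D v → Reach (E G) D u v) ×
  ¬ (Σ (Occ P (n G)) λ o → InducedOcc (E G) o × (∀ v → OccVert o v → D v))

data Phase1Step (P : Problem) : Graph → ℕ → Graph → ℕ → Set₁ where
  irrelevantEdge : ∀ {G k} (x y : Fin (n G)) → E G x y →
    ¬ (Σ (Occ P (n G)) λ o → SubOcc (E G) o × OccEdge o x y) →
    Phase1Step P G k (deleteEdge G x y) k
  sunflower : ∀ {G k} (x y : Fin (n G)) → E G x y →
    Sunflower G x y (suc k) →
    Phase1Step P G (suc k) (deleteEdge G x y) k
  vertexSplit : ∀ {G H k} (π : Fin (n H) → Fin (n G)) (v : Fin (n G)) →
    VertexSplit G H π v → Phase1Step P G k H k
  irrelevantComponent : ∀ {G H k} (D : Fin (n G) → Set) (f : Fin (n H) → Fin (n G)) →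
    IrrelevantComponent P G D → InducedVia G (λ u → ¬ D u) H f →
    Phase1Step P G k H k

Phase1Exhausted : Problem → Graph → ℕ → Set₁
Phase1Exhausted P G k = ∀ H k' → ¬ Phase1Step P G k H k'

data Phase1 (P : Problem) : Graph → ℕ → Graph → ℕ → Set₁ where
  done : ∀ {G k} → Phase1Exhausted P G k → Phase1 P G k G k
  more : ∀ {G k G₁ k₁ G₂ k₂} → Phase1Step P G k G₁ k₁ → Phase1 P G₁ k₁ G₂ k₂ →
         Phase1 P G k G₂ k₂

InX : ∀ {P n} → List (Occ P n) → Fin n → Fin n → Set
InX os u v = Any (λ o → OccEdge o u v) os

Minus : ∀ {P n} → Rel n → List (Occ P n) → Rel n
Minus A os u v = A u v × ¬ InX os u v

-- the list (most recent first) of packed forbidden graphs; each one is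
-- induced in (V, E ∖ edges of the earlier ones)
data Packing {P n} (A : Rel n) : List (Occ P n) → Set where
  []  : Packing A []
  _∷_ : ∀ {o os} → InducedOcc (Minus A os) o → Packing A os → Packing A (o ∷ os)

GreedyPacking : ∀ {P n} → Rel n → List (Occ P n) → Set
GreedyPacking {P} {n} A os =
  Packing A os × ¬ (Σ (Occ P n) λ o → InducedOcc (Minus A os) o)

VX : ∀ {P n} → List (Occ P n) → Fin n → Set
VX os v = ∃[ u ] InX os u v

IsCliqueOut : (H : Graph) → (Fin (n H) → Set) → (Fin (n H) → Set) → Set
IsCliqueOut H W C = (∀ v → C v → ¬ W v) × (∀ u v → C u → C v → u ≢ v → E H u v)

IsMaxCliqueOut : (H : Graph) → (Fin (n H) → Set) → (Fin (n H) → Set) → Set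
IsMaxCliqueOut H W C =
  IsCliqueOut H W C × (∀ u → ¬ W u → (∀ v → C v → u ≢ v → E H u v) → C u)

AC : (H : Graph) → (Fin (n H) → Set) → (Fin (n H) → Set) → Fin (n H) → Set
AC H W C a = W a × (∀ c → C c → E H a c)

C'' : (H : Graph) → (Fin (n H) → Set) → (Fin (n H) → Set) → Fin (n H) → Set
C'' H W C v = C v × (∀ u → E H v u → C u ⊎ AC H W C u)

-- one application of the clique reduction rule (budget k'), keeping
-- exactly one vertex r of C''; W is V_X, transported along deletions
data CliqueStep (k' : ℕ) : (H : Graph) → (Fin (n H) → Set) →
                           (H' : Graph) → (Fin (n H') → Set) → Set₁ where
  reduce : ∀ {H W H'} (C : Fin (n H) → Set) (r r₂ : Fin (n H))
    (f : Fin (n H') → Fin (n H)) →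
    IsMaxCliqueOut H W C → AtLeast 3 C → AtLeast (suc (4 * k')) C →
    C'' H W C r → C'' H W C r₂ → r ≢ r₂ →
    InducedVia H (λ u → ¬ C'' H W C u ⊎ u ≡ r) H' f →
    CliqueStep k' H W H' (λ i → W (f i))

CliqueExhausted : ℕ → (H : Graph) → (Fin (n H) → Set) → Set₁
CliqueExhausted k' H W = ∀ H' W' → ¬ CliqueStep k' H W H' W'

data CliqueRun (k' : ℕ) : (H : Graph) → (Fin (n H) → Set) →
                          (H' : Graph) → (Fin (n H') → Set) → Set₁ where
  done : ∀ {H W} → CliqueExhausted k' H W → CliqueRun k' H W H W
  more : ∀ {H W H₁ W₁ H₂ W₂} → CliqueStep k' H W H₁ W₁ → CliqueRun k' H₁ W₁ H₂ W₂ →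
         CliqueRun k' H W H₂ W₂

-- The kernelizations: Kernel P G k H W means that on input (G,k) the
-- kernelization outputs graph H (not declaring a no-instance), and W is
-- the set V_X, as a subset of V(H).

data Kernel : Problem → Graph → ℕ → (H : Graph) → (Fin (n H) → Set) → Set₁ where
  kernelDiamond : ∀ {G k G₁ k₁ H W} (os : List (Occ diamondFree (n G₁))) →
    Phase1 diamondFree G k G₁ k₁ → GreedyPacking (E G₁) os → length os ≤ k₁ →
    CliqueRun k₁ G₁ (VX os) H W →
    Kernel diamondFree G k H W
  kernelDiamondK : ∀ {t G k G₁ k₁} (os : List (Occ (diamondKFree t) (n G₁))) →
    Phase1 (diamondKFree t) G k G₁ k₁ → GreedyPacking (E G₁) os → length os ≤ k₁ →
    Kernel (diamondKFree t) G k G₁ (VX os)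

module Submission where

-- A singleton clique {s} of G − V_X has all its neighbours in V_X. In the Phase 1 output s is not isolated
-- (Irrelevant component) and its edges lie in forbidden graphs (Irrelevant edge), so s lies in a triangle sxy
-- with x, y ∈ V_X. If xy ∈ X there are O(k) choices of xy and, by the Sunflower rule, at most 2k+1 such s for
-- each; if xy ∉ X, two such s would span a diamond avoiding X, contradicting the maximality of the packing,
-- and there are O(k²) choices of x, y ∈ V_X. A clique reduction leaves a singleton r only when the whole clique C
-- was a component of G − V_X; C then has two attachments in V_X (Irrelevant component, Vertex-split), both
-- adjacent to all of C, and they again give a triangle at r or a diamond avoiding X.
-- Adjacency is not decidable here, so the argument runs in the double-negation monad; the bound is decidable.

open import Defs
open import Level using (0ℓ)
open import Function using (_∘_)
open import Data.Nat using (ℕ; zero; suc; _+_; _*_; _≤_; z≤n; s≤s; _≤?_)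
import Data.Nat.Properties as ℕ
open import Data.Nat.Solver using (module +-*-Solver)
open import Data.Fin using (Fin; zero; suc; _↑ˡ_; _↑ʳ_; splitAt; combine; punchOut; inject≤)
import Data.Fin as Fin
import Data.Fin.Properties as Finₚ
open import Data.Fin.Properties using (_≟_)
open import Data.Product using (Σ; ∃; ∃₂; _×_; _,_; ∃-syntax; proj₁; proj₂)
open import Data.Sum using (_⊎_; inj₁; inj₂)
import Data.Sum as Sum
open import Data.Empty using (⊥; ⊥-elim)
open import Data.List using (List; []; _∷_; _++_; length; lookup; concatMap; tabulate; cartesianProduct; map)
import Data.List.Properties as Listₚ
open import Data.List.Membership.Propositional using (_∈_)
open import Data.List.Membership.Propositional.Properties
  using (∈-++⁺ˡ; ∈-++⁺ʳ; ∈-concatMap⁺; ∈-cartesianProduct⁺; ∈-tabulate⁺)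
import Data.List.Relation.Unary.Any as Any
open import Data.List.Relation.Unary.Any using (Any; here; there)
open import Data.List.Relation.Unary.Any.Properties using (lookup-index)
open import Effect.Monad using (RawMonad)
open import Relation.Nullary using (¬_; Dec; yes; no)
open import Relation.Nullary.Negation using (¬¬-Monad)
open import Relation.Nullary.Decidable using (¬¬-excluded-middle; decidable-stable; _×-dec_; _⊎-dec_; ¬?)
open import Relation.Binary.PropositionalEquality
  using (_≡_; _≢_; refl; trans; cong; cong₂; subst; module ≡-Reasoning) renaming (sym to ≡-sym)

open RawMonad (¬¬-Monad {a = 0ℓ}) using (pure; _>>=_)

¬¬-Π-Fin : ∀ {m} {P : Fin m → Set} → (∀ x → ¬ ¬ (P x)) → ¬ ¬ (∀ x → P x)
¬¬-Π-Fin {zero} h = pure (λ ())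
¬¬-Π-Fin {suc m} {P} h = do
  p₀ ← h zero
  ps ← ¬¬-Π-Fin {P = P ∘ suc} (h ∘ suc)
  pure λ { zero → p₀ ; (suc x) → ps x }

¬¬-decidable : ∀ {m} (P : Fin m → Set) → ¬ ¬ (∀ x → Dec (P x))
¬¬-decidable P = ¬¬-Π-Fin (λ x → ¬¬-excluded-middle)

¬¬-decidable₂ : ∀ {m} (R : Rel m) → ¬ ¬ (∀ x y → Dec (R x y))
¬¬-decidable₂ R = ¬¬-Π-Fin (λ x → ¬¬-decidable (R x))

module _ {m} {A : Rel m} {D : Fin m → Set} where

  reach-start : ∀ {u w} → Reach A D u w → D u
  reach-start (here d) = d
  reach-start (step d _ _) = d

  reach-end : ∀ {u w} → Reach A D u w → D w
  reach-end (here d) = d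
  reach-end (step _ _ r) = reach-end r

  reach-trans : ∀ {u v w} → Reach A D u v → Reach A D v w → Reach A D u w
  reach-trans (here _) q = q
  reach-trans (step d e r) q = step d e (reach-trans r q)

  reach-snoc : ∀ {u v w} → Reach A D u v → D w → A v w → Reach A D u w
  reach-snoc r d e = reach-trans r (step (reach-end r) e (here d))

  reach-sym : (∀ {x y} → A x y → A y x) → ∀ {u w} → Reach A D u w → Reach A D w u
  reach-sym s (here d) = here d
  reach-sym s (step d e r) = reach-snoc (reach-sym s r) d (s e)

reach-mono : ∀ {m} {A : Rel m} {D D' : Fin m → Set} → (∀ x → D x → D' x) →
  ∀ {u w} → Reach A D u w → Reach A D' u w
reach-mono f (here d) = here (f _ d)
reach-mono f (step d e r) = step (f _ d) e (reach-mono f r)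

record Partition {m} (P : Fin m → Set) : Set where
  field
    #in #out : ℕ
    #in+#out : #in + #out ≡ m
    inside : Fin #in → Fin m
    outside : Fin #out → Fin m
    inside-injective : InjectiveFn inside
    outside-injective : InjectiveFn outside
    inside-P : ∀ i → P (inside i)
    outside-¬P : ∀ i → ¬ P (outside i)
    covers : ∀ x → (∃[ i ] inside i ≡ x) ⊎ (∃[ i ] outside i ≡ x)

private
  lift₁ : ∀ {a m} → (Fin a → Fin m) → Fin (suc a) → Fin (suc m)
  lift₁ f zero = zero
  lift₁ f (suc i) = suc (f i)

  lift₁-injective : ∀ {a m} (f : Fin a → Fin m) → InjectiveFn f → InjectiveFn (lift₁ f)
  lift₁-injective f inj zero zero e = refl
  lift₁-injective f inj (suc i) (suc j) e = cong suc (inj i j (Finₚ.suc-injective e))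

  suc∘-injective : ∀ {a m} (f : Fin a → Fin m) → InjectiveFn f → InjectiveFn (suc ∘ f)
  suc∘-injective f inj i j e = inj i j (Finₚ.suc-injective e)

partition : ∀ {m} (P : Fin m → Set) → (∀ x → Dec (P x)) → Partition P
partition {zero} P P? = record
  { #in = 0 ; #out = 0 ; #in+#out = refl ; inside = λ () ; outside = λ ()
  ; inside-injective = λ () ; outside-injective = λ () ; inside-P = λ () ; outside-¬P = λ () ; covers = λ () }
partition {suc m} P P? with partition (P ∘ suc) (P? ∘ suc) | P? zero
... | r | yes p₀ = record
  { #in = suc #in ; #out = #out ; #in+#out = cong suc #in+#out
  ; inside = lift₁ inside ; outside = suc ∘ outside
  ; inside-injective = lift₁-injective inside inside-injective
  ; outside-injective = suc∘-injective outside outside-injective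
  ; inside-P = λ { zero → p₀ ; (suc i) → inside-P i } ; outside-¬P = outside-¬P
  ; covers = λ { zero → inj₁ (zero , refl)
               ; (suc x) → Sum.map (λ (i , e) → suc i , cong suc e) (λ (i , e) → i , cong suc e) (covers x) } }
  where open Partition r
... | r | no ¬p₀ = record
  { #in = #in ; #out = suc #out ; #in+#out = trans (ℕ.+-suc #in #out) (cong suc #in+#out)
  ; inside = suc ∘ inside ; outside = lift₁ outside
  ; inside-injective = suc∘-injective inside inside-injective
  ; outside-injective = lift₁-injective outside outside-injective
  ; inside-P = inside-P ; outside-¬P = λ { zero → ¬p₀ ; (suc i) → outside-¬P i }
  ; covers = λ { zero → inj₂ (zero , refl)
               ; (suc x) → Sum.map (λ (i , e) → i , cong suc e) (λ (i , e) → suc i , cong suc e) (covers x) } }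
  where open Partition r

pigeonhole : ∀ B b {m} (ℓ : Fin m → Fin B) → (∀ y → ¬ AtLeast (suc b) (λ x → ℓ x ≡ y)) → m ≤ B * b
pigeonhole zero b {zero} ℓ small = z≤n
pigeonhole zero b {suc m} ℓ small with ℓ zero
... | ()
pigeonhole (suc B) b {m} ℓ small = subst (_≤ suc B * b) #in+#out (ℕ.+-mono-≤ #in≤b #out≤Bb)
  where
    open Partition (partition (λ x → ℓ x ≡ zero) (λ x → ℓ x ≟ zero))
    #in≤b : #in ≤ b
    #in≤b with #in ≤? b
    ... | yes le = le
    ... | no nle = ⊥-elim (small zero (pick , pick-injective , inside-P ∘ inject≤′))
      where
        b<#in : suc b ≤ #in
        b<#in = ℕ.≰⇒> nle
        inject≤′ : Fin (suc b) → Fin #in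
        inject≤′ i = inject≤ i b<#in
        pick : Fin (suc b) → Fin m
        pick = inside ∘ inject≤′
        pick-injective : InjectiveFn pick
        pick-injective i j e = Finₚ.inject≤-injective b<#in b<#in i j (inside-injective _ _ e)
    relabel : Fin #out → Fin B
    relabel i = punchOut (outside-¬P i ∘ ≡-sym)
    #out≤Bb : #out ≤ B * b
    #out≤Bb = pigeonhole B b relabel λ y (g , g-inj , g-fibre) → small (suc y)
      ( outside ∘ g , (λ i j e → g-inj i j (outside-injective _ _ e))
      , λ i → trans (≡-sym (Finₚ.punchIn-punchOut (outside-¬P (g i) ∘ ≡-sym))) (cong (Fin.punchIn zero) (g-fibre i)))

UEq-sym : ∀ {m} {u v x y : Fin m} → UEq u v x y → UEq v u x y
UEq-sym (inj₁ (p , q)) = inj₂ (q , p)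
UEq-sym (inj₂ (p , q)) = inj₁ (q , p)

OccEdge-sym : ∀ {P m} (o : Occ P m) {u v} → OccEdge o u v → OccEdge o v u
OccEdge-sym (dia a b c d) = Sum.map UEq-sym (Sum.map UEq-sym (Sum.map UEq-sym (Sum.map UEq-sym UEq-sym)))
OccEdge-sym (kt f) (i , j , i≢j , p , q) = j , i , i≢j ∘ ≡-sym , q , p

module _ {P m} {os : List (Occ P m)} where

  InX-sym : ∀ {u v} → InX os u v → InX os v u
  InX-sym = Any.map (λ {o} → OccEdge-sym o)

  InX⇒VXˡ : ∀ {u v} → InX os u v → VX os u
  InX⇒VXˡ {v = v} p = v , InX-sym p

  InX⇒VXʳ : ∀ {u v} → InX os u v → VX os v
  InX⇒VXʳ {u = u} p = u , p

  InX? : ∀ u v → Dec (InX os u v)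
  InX? u v = Any.any? (λ o → OccEdge? o) os
    where
      UEq? : ∀ x y → Dec (UEq u v x y)
      UEq? x y = ((u ≟ x) ×-dec (v ≟ y)) ⊎-dec ((u ≟ y) ×-dec (v ≟ x))
      OccEdge? : ∀ o → Dec (OccEdge o u v)
      OccEdge? (dia a b c d) = UEq? a b ⊎-dec UEq? a c ⊎-dec UEq? a d ⊎-dec UEq? b c ⊎-dec UEq? b d
      OccEdge? (kt f) = Finₚ.any? λ i → Finₚ.any? λ j → ¬? (i ≟ j) ×-dec (f i ≟ u) ×-dec (f j ≟ v)

  VX? : ∀ v → Dec (VX os v)
  VX? v = Finₚ.any? (λ u → InX? u v)

  induced-avoids-X : ∀ {A : Rel m} (o : Occ P m) → InducedOcc A o →
    (∀ x y → OccVert o x → OccVert o y → VX os x → VX os y → x ≡ y) →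
    InducedOcc (Minus A os) o
  induced-avoids-X (dia a b c d) ((a≢b , a≢c , a≢d , b≢c , b≢d , c≢d) , ab , ac , ad , bc , bd , ¬cd) ≤one =
    (a≢b , a≢c , a≢d , b≢c , b≢d , c≢d) ,
    (ab , ∉X a′ b′ a≢b) , (ac , ∉X a′ c′ a≢c) , (ad , ∉X a′ d′ a≢d) ,
    (bc , ∉X b′ c′ b≢c) , (bd , ∉X b′ d′ b≢d) , ¬cd ∘ proj₁
    where
      a′ : OccVert (dia {P} a b c d) a
      a′ = inj₁ refl
      b′ : OccVert (dia {P} a b c d) b
      b′ = inj₂ (inj₁ refl)
      c′ : OccVert (dia {P} a b c d) c
      c′ = inj₂ (inj₂ (inj₁ refl))
      d′ : OccVert (dia {P} a b c d) d
      d′ = inj₂ (inj₂ (inj₂ refl))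
      ∉X : ∀ {x y} → OccVert (dia {P} a b c d) x → OccVert (dia {P} a b c d) y → x ≢ y → ¬ InX os x y
      ∉X x′ y′ x≢y p = x≢y (≤one _ _ x′ y′ (InX⇒VXˡ p) (InX⇒VXʳ p))
  induced-avoids-X (kt f) (f-inj , clique) ≤one =
    f-inj , λ i j i≢j → clique i j i≢j ,
      λ p → i≢j (f-inj i j (≤one _ _ (i , refl) (j , refl) (InX⇒VXˡ p) (InX⇒VXʳ p)))

Triangle : (G : Graph) → Fin (n G) → Set
Triangle G s = Σ (Fin (n G)) λ y → Σ (Fin (n G)) λ z → E G s y × E G s z × E G y z

third-index : ∀ {t} → 3 ≤ t → (i j : Fin t) → ∃ λ l → i ≢ l × j ≢ l
third-index (s≤s (s≤s (s≤s _))) zero zero = suc zero , (λ ()) , (λ ())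
third-index (s≤s (s≤s (s≤s _))) zero (suc zero) = suc (suc zero) , (λ ()) , (λ ())
third-index (s≤s (s≤s (s≤s _))) zero (suc (suc j)) = suc zero , (λ ()) , (λ ())
third-index (s≤s (s≤s (s≤s _))) (suc zero) zero = suc (suc zero) , (λ ()) , (λ ())
third-index (s≤s (s≤s (s≤s _))) (suc zero) (suc zero) = zero , (λ ()) , (λ ())
third-index (s≤s (s≤s (s≤s _))) (suc zero) (suc (suc j)) = zero , (λ ()) , (λ ())
third-index (s≤s (s≤s (s≤s _))) (suc (suc i)) zero = suc zero , (λ ()) , (λ ())
third-index (s≤s (s≤s (s≤s _))) (suc (suc i)) (suc zero) = zero , (λ ()) , (λ ())
third-index (s≤s (s≤s (s≤s _))) (suc (suc i)) (suc (suc j)) = zero , (λ ()) , (λ ())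

occurrence-edge-in-triangle : ∀ {P} → ValidProblem P → (G : Graph) (o : Occ P (n G)) → SubOcc (E G) o →
  ∀ {s x} → OccEdge o s x → Triangle G s
occurrence-edge-in-triangle {P} _ G (dia a b c d) (_ , ab , ac , ad , bc , bd) = at-endpoint
  where
    at : ∀ {s y} → s ≡ y → Triangle G y → Triangle G s
    at refl t = t
    tri-a : Triangle G a
    tri-a = b , c , ab , ac , bc
    tri-b : Triangle G b
    tri-b = a , c , sym G ab , bc , ac
    tri-c : Triangle G c
    tri-c = a , b , sym G ac , sym G bc , ab
    tri-d : Triangle G d
    tri-d = a , b , sym G ad , sym G bd , ab
    at-pair : ∀ {s x y z} → Triangle G y → Triangle G z → UEq s x y z → Triangle G s
    at-pair ty tz (inj₁ (p , _)) = at p ty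
    at-pair ty tz (inj₂ (p , _)) = at p tz
    at-endpoint : ∀ {s x} → OccEdge (dia {P} a b c d) s x → Triangle G s
    at-endpoint (inj₁ u) = at-pair tri-a tri-b u
    at-endpoint (inj₂ (inj₁ u)) = at-pair tri-a tri-c u
    at-endpoint (inj₂ (inj₂ (inj₁ u))) = at-pair tri-a tri-d u
    at-endpoint (inj₂ (inj₂ (inj₂ (inj₁ u)))) = at-pair tri-b tri-c u
    at-endpoint (inj₂ (inj₂ (inj₂ (inj₂ u)))) = at-pair tri-b tri-d u
occurrence-edge-in-triangle 4≤t G (kt f) (_ , clique) (i , j , i≢j , refl , _) with third-index (ℕ.<⇒≤ 4≤t) i j
... | l , i≢l , j≢l = f j , f l , clique i j i≢j , clique i l i≢l , clique j l j≢l

occurrence-not-single-vertex : ∀ {P m} {A : Rel m} → ValidProblem P → (o : Occ P m) → InducedOcc A o →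
  ∀ s → ¬ (∀ v → OccVert o v → v ≡ s)
occurrence-not-single-vertex _ (dia a b c d) ((a≢b , _) , _) s single =
  a≢b (trans (single a (inj₁ refl)) (≡-sym (single b (inj₂ (inj₁ refl)))))
occurrence-not-single-vertex (s≤s (s≤s _)) (kt f) (f-inj , _) s single
  with f-inj zero (suc zero) (trans (single _ (zero , refl)) (≡-sym (single _ (suc zero , refl))))
... | ()

length-concatMap-≤ : ∀ {A B : Set} (f : A → List B) {b} → (∀ x → length (f x) ≤ b) →
  ∀ xs → length (concatMap f xs) ≤ length xs * b
length-concatMap-≤ f bound [] = z≤n
length-concatMap-≤ f bound (x ∷ xs) = begin
  length (f x ++ concatMap f xs)        ≡⟨ Listₚ.length-++ (f x) ⟩
  length (f x) + length (concatMap f xs) ≤⟨ ℕ.+-mono-≤ (bound x) (length-concatMap-≤ f bound xs) ⟩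
  _                                      ∎
  where open ℕ.≤-Reasoning

length-cartesianProduct : ∀ {A B : Set} (xs : List A) (ys : List B) →
  length (cartesianProduct xs ys) ≡ length xs * length ys
length-cartesianProduct [] ys = refl
length-cartesianProduct (x ∷ xs) ys = begin
  length (map (x ,_) ys ++ cartesianProduct xs ys)      ≡⟨ Listₚ.length-++ (map (x ,_) ys) ⟩
  length (map (x ,_) ys) + length (cartesianProduct xs ys)
    ≡⟨ cong₂ _+_ (Listₚ.length-map (x ,_) ys) (length-cartesianProduct xs ys) ⟩
  length ys + length xs * length ys                       ∎
  where open ≡-Reasoning

occEdges : ∀ {P m} → Occ P m → List (Fin m × Fin m)
occEdges (dia a b c d) = (a , b) ∷ (a , c) ∷ (a , d) ∷ (b , c) ∷ (b , d) ∷ []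
occEdges (kt f) = cartesianProduct (tabulate f) (tabulate f)

edgeBound : Problem → ℕ
edgeBound diamondFree = 5
edgeBound (diamondKFree t) = 5 + t * t

length-occEdges : ∀ {P m} (o : Occ P m) → length (occEdges o) ≤ edgeBound P
length-occEdges {diamondFree} (dia a b c d) = ℕ.≤-refl
length-occEdges {diamondKFree t} (dia a b c d) = ℕ.m≤m+n 5 (t * t)
length-occEdges {diamondKFree t} (kt f) = begin
  length (cartesianProduct (tabulate f) (tabulate f)) ≡⟨ length-cartesianProduct (tabulate f) (tabulate f) ⟩
  length (tabulate f) * length (tabulate f)           ≡⟨ cong₂ _*_ (Listₚ.length-tabulate f) (Listₚ.length-tabulate f) ⟩
  t * t                                               ≤⟨ ℕ.m≤n+m (t * t) 5 ⟩
  5 + t * t                                           ∎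
  where open ℕ.≤-Reasoning

OccEdge⇒∈occEdges : ∀ {P m} (o : Occ P m) {u v} → OccEdge o u v →
  ∃[ e ] (e ∈ occEdges o × UEq u v (proj₁ e) (proj₂ e))
OccEdge⇒∈occEdges (dia a b c d) (inj₁ p) = _ , here refl , p
OccEdge⇒∈occEdges (dia a b c d) (inj₂ (inj₁ p)) = _ , there (here refl) , p
OccEdge⇒∈occEdges (dia a b c d) (inj₂ (inj₂ (inj₁ p))) = _ , there (there (here refl)) , p
OccEdge⇒∈occEdges (dia a b c d) (inj₂ (inj₂ (inj₂ (inj₁ p)))) = _ , there (there (there (here refl))) , p
OccEdge⇒∈occEdges (dia a b c d) (inj₂ (inj₂ (inj₂ (inj₂ p)))) = _ , there (there (there (there (here refl)))) , p
OccEdge⇒∈occEdges (kt f) (i , j , _ , refl , refl) =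
  _ , ∈-cartesianProduct⁺ (∈-tabulate⁺ i) (∈-tabulate⁺ j) , inj₁ (refl , refl)

packedEdges : ∀ {P m} → List (Occ P m) → List (Fin m × Fin m)
packedEdges = concatMap occEdges

endpoints : ∀ {m} → Fin m × Fin m → List (Fin m)
endpoints (x , y) = x ∷ y ∷ []

packedVertices : ∀ {P m} → List (Occ P m) → List (Fin m)
packedVertices os = concatMap endpoints (packedEdges os)

InX⇒∈packedEdges : ∀ {P m} {os : List (Occ P m)} {u v} → InX os u v →
  ∃[ e ] (e ∈ packedEdges os × UEq u v (proj₁ e) (proj₂ e))
InX⇒∈packedEdges {os = o ∷ _} (here p) with OccEdge⇒∈occEdges o p
... | e , e∈ , u = e , ∈-++⁺ˡ e∈ , u
InX⇒∈packedEdges {os = o ∷ _} (there p) with InX⇒∈packedEdges p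
... | e , e∈ , u = e , ∈-++⁺ʳ (occEdges o) e∈ , u

module _ {P m} {os : List (Occ P m)} where

  VX⇒∈packedVertices : ∀ {v} → VX os v → v ∈ packedVertices os
  VX⇒∈packedVertices (u , p) with InX⇒∈packedEdges p
  ... | e , e∈ , u = ∈-concatMap⁺ endpoints (Any.map (λ { refl → endpoint u }) e∈)
    where
      endpoint : ∀ {u v x y} → UEq u v x y → v ∈ endpoints {m} (x , y)
      endpoint (inj₁ (_ , refl)) = there (here refl)
      endpoint (inj₂ (_ , refl)) = here refl

  length-packedEdges : length (packedEdges os) ≤ length os * edgeBound P
  length-packedEdges = length-concatMap-≤ occEdges length-occEdges os

  length-packedVertices : length (packedVertices os) ≤ length (packedEdges os) * 2
  length-packedVertices = length-concatMap-≤ _ (λ _ → ℕ.≤-refl) (packedEdges os)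

delete-vertices : (G : Graph) (D : Fin (n G) → Set) → (∀ u → Dec (D u)) →
  Σ Graph λ H → Σ (Fin (n H) → Fin (n G)) λ f → InducedVia G (λ u → ¬ D u) H f
delete-vertices G D D? = H , outside , outside-injective , outside-¬P , onto , (λ _ _ e → e) , (λ _ _ e → e)
  where
    open Partition (partition D D?)
    H : Graph
    H = record { n = #out ; E = λ i j → E G (outside i) (outside j) ; sym = sym G ; irrefl = irrefl G }
    onto : ∀ v → ¬ D v → ∃[ i ] outside i ≡ v
    onto v ¬Dv with covers v
    ... | inj₁ (i , refl) = ⊥-elim (¬Dv (inside-P i))
    ... | inj₂ p = p

least-witness : ∀ {m} (Q : Fin m → Set) → (∀ x → Dec (Q x)) → ∀ x → Q x →
  ∃ λ u → Q u × (∀ w → Q w → u Fin.≤ w)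
least-witness {suc m} Q Q? x qx with Q? zero
... | yes q₀ = zero , q₀ , λ _ _ → z≤n
least-witness {suc m} Q Q? zero qx | no ¬q₀ = ⊥-elim (¬q₀ qx)
least-witness {suc m} Q Q? (suc x) qx | no ¬q₀ with least-witness (Q ∘ suc) (Q? ∘ suc) x qx
... | u , qu , minimal = suc u , qu , λ { zero q → ⊥-elim (¬q₀ q) ; (suc w) q → s≤s (minimal w q) }

module _ {P : Problem} {G : Graph} {k : ℕ} (exhausted : Phase1Exhausted P G k) where

  exhausted⇒no-irrelevant-component : (D : Fin (n G) → Set) → (∀ u → Dec (D u)) → ¬ IrrelevantComponent P G D
  exhausted⇒no-irrelevant-component D D? irrelevant with delete-vertices G D D?
  ... | H , f , induced = exhausted H k (irrelevantComponent D f irrelevant induced)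

  exhausted⇒edge-in-occurrence : ∀ {x y} → E G x y → ¬ ¬ (Σ (Occ P (n G)) λ o → SubOcc (E G) o × OccEdge o x y)
  exhausted⇒edge-in-occurrence {x} {y} xy irrelevant = exhausted (deleteEdge G x y) k (irrelevantEdge x y xy irrelevant)

module VertexSplitting (G : Graph) (v : Fin (n G))
  (N? : ∀ u → Dec (E G v u)) (_~?_ : ∀ x y → Dec (Reach (E G) (E G v) x y)) where

  _~_ : Rel (n G)
  x ~ y = Reach (E G) (E G v) x y

  ~-sym : ∀ {x y} → x ~ y → y ~ x
  ~-sym = reach-sym (sym G)

  Leader : Fin (n G) → Set
  Leader u = E G v u × (∀ w → w ~ u → u Fin.≤ w)

  Leader? : ∀ u → Dec (Leader u)
  Leader? u = N? u ×-dec Finₚ.all? below?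
    where
      below? : ∀ w → Dec (w ~ u → u Fin.≤ w)
      below? w with w ~? u | u Fin.≤? w
      ... | _ | yes u≤w = yes λ _ → u≤w
      ... | no ≁ | no _ = yes λ w~u → ⊥-elim (≁ w~u)
      ... | yes w~u | no u≰w = no λ f → u≰w (f w~u)

  leader-unique : ∀ {u u' a} → Leader u → Leader u' → u ~ a → u' ~ a → u ≡ u'
  leader-unique (_ , u-least) (_ , u'-least) u~a u'~a =
    Finₚ.≤-antisym (u-least _ (reach-trans u'~a (~-sym u~a))) (u'-least _ (reach-trans u~a (~-sym u'~a)))

  module Leaders = Partition (partition Leader Leader?)
  module Others = Partition (partition (_≡ v) (_≟ v))
  open Leaders using () renaming (#in to t; inside to leader)
  open Others using () renaming (#out to O; outside to old)

  leader-of : ∀ a → E G v a → ∃ λ j → leader j ~ a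
  leader-of a va with least-witness (_~ a) (_~? a) a (here va)
  ... | u , u~a , u-least with Leaders.covers u
  ... | inj₁ (j , refl) = j , u~a
  ... | inj₂ (i , refl) = ⊥-elim (Leaders.outside-¬P i (reach-start u~a , λ w w~u → u-least w (reach-trans w~u u~a)))

  old-of : ∀ u → u ≢ v → ∃ λ i → old i ≡ u
  old-of u u≢v with Others.covers u
  ... | inj₁ (i , refl) = ⊥-elim (u≢v (Others.inside-P i))
  ... | inj₂ p = p

  neighbour-≢ : ∀ {a} → E G v a → a ≢ v
  neighbour-≢ va refl = irrefl G va

  -- old vertices come first, then one copy of v per component of G[N(v)]
  Vertex : Set
  Vertex = Fin O ⊎ Fin t

  origin : Vertex → Fin (n G)
  origin (inj₁ i) = old i
  origin (inj₂ _) = v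

  Adj : Vertex → Vertex → Set
  Adj (inj₁ i) (inj₁ i') = E G (old i) (old i')
  Adj (inj₁ i) (inj₂ j) = E G v (old i) × leader j ~ old i
  Adj (inj₂ j) (inj₁ i) = E G v (old i) × leader j ~ old i
  Adj (inj₂ _) (inj₂ _) = ⊥

  Adj-sym : ∀ x y → Adj x y → Adj y x
  Adj-sym (inj₁ i) (inj₁ i') e = sym G e
  Adj-sym (inj₁ i) (inj₂ j) e = e
  Adj-sym (inj₂ j) (inj₁ i) e = e

  Adj-irrefl : ∀ x → ¬ Adj x x
  Adj-irrefl (inj₁ i) e = irrefl G e

  Split : Graph
  Split = record
    { n = O + t ; E = λ x y → Adj (splitAt O x) (splitAt O y)
    ; sym = λ {x} {y} → Adj-sym (splitAt O x) (splitAt O y) ; irrefl = λ {x} → Adj-irrefl (splitAt O x) }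

  π : Fin (O + t) → Fin (n G)
  π x = origin (splitAt O x)

  oldᴴ : Fin O → Fin (O + t)
  oldᴴ i = i ↑ˡ t

  copyᴴ : Fin t → Fin (O + t)
  copyᴴ j = O ↑ʳ j

  π-old : ∀ i → π (oldᴴ i) ≡ old i
  π-old i rewrite Finₚ.splitAt-↑ˡ O i t = refl

  π-copy : ∀ j → π (copyᴴ j) ≡ v
  π-copy j rewrite Finₚ.splitAt-↑ʳ O t j = refl

  copy-adj : ∀ i j → E G v (old i) → leader j ~ old i → E Split (copyᴴ j) (oldᴴ i)
  copy-adj i j vi ji rewrite Finₚ.splitAt-↑ʳ O t j | Finₚ.splitAt-↑ˡ O i t = vi , ji

  old-neighbour : ∀ j a → leader j ~ a → ∃[ w ] (π w ≡ a × E Split (copyᴴ j) w)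
  old-neighbour j a j~a with old-of a (neighbour-≢ (reach-end j~a))
  ... | i , refl = oldᴴ i , π-old i , copy-adj i j (reach-end j~a) j~a

  is-vertex-split : ∀ {x y} → E G v x → E G v y → ¬ x ~ y → VertexSplit G Split π v
  is-vertex-split {x} {y} vx vy x≁y =
    old-once , old-unique , old-edges , old-edges⁻ , copies-independent , copy-neighbourhood ,
    copies-disjoint , neighbours-covered , two-copies
    where
      old-once : ∀ u → u ≢ v → ∃[ w ] π w ≡ u
      old-once u u≢v with old-of u u≢v
      ... | i , refl = oldᴴ i , π-old i

      old-unique : ∀ w w' → π w ≡ π w' → π w ≢ v → w ≡ w'
      old-unique w w' eq ≢v with splitAt O w in e | splitAt O w' in e'
      ... | inj₁ i | inj₁ i' = trans (≡-sym (Finₚ.splitAt⁻¹-↑ˡ e))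
                                (trans (cong oldᴴ (Others.outside-injective i i' eq)) (Finₚ.splitAt⁻¹-↑ˡ e'))
      ... | inj₁ i | inj₂ _ = ⊥-elim (≢v eq)
      ... | inj₂ _ | _ = ⊥-elim (≢v refl)

      old-edges : ∀ w w' → π w ≢ v → π w' ≢ v → E Split w w' → E G (π w) (π w')
      old-edges w w' ≢v ≢v' e with splitAt O w | splitAt O w'
      ... | inj₁ _ | inj₁ _ = e
      ... | inj₁ _ | inj₂ _ = ⊥-elim (≢v' refl)
      ... | inj₂ _ | _ = ⊥-elim (≢v refl)

      old-edges⁻ : ∀ w w' → π w ≢ v → π w' ≢ v → E G (π w) (π w') → E Split w w'
      old-edges⁻ w w' ≢v ≢v' e with splitAt O w | splitAt O w'
      ... | inj₁ _ | inj₁ _ = e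
      ... | inj₁ _ | inj₂ _ = ⊥-elim (≢v' refl)
      ... | inj₂ _ | _ = ⊥-elim (≢v refl)

      copies-independent : ∀ w w' → π w ≡ v → π w' ≡ v → ¬ E Split w w'
      copies-independent w w' ≡v ≡v' e with splitAt O w | splitAt O w'
      ... | inj₁ i | _ = Others.outside-¬P i ≡v
      ... | inj₂ _ | inj₁ i = Others.outside-¬P i ≡v'

      copy-neighbourhood : ∀ w → π w ≡ v →
        (∀ w' → E Split w w' → E G v (π w')) ×
        (∃[ w' ] E Split w w') ×
        (∀ w₁ w₂ → E Split w w₁ → E Split w w₂ → π w₁ ~ π w₂) ×
        (∀ w₁ a → E Split w w₁ → π w₁ ~ a → ∃[ w₂ ] (π w₂ ≡ a × E Split w w₂))
      copy-neighbourhood w ≡v with splitAt O w in e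
      ... | inj₁ i = ⊥-elim (Others.outside-¬P i ≡v)
      ... | inj₂ j = inside-N , nonempty , connected , closed
        where
          w≡copy : w ≡ copyᴴ j
          w≡copy = ≡-sym (Finₚ.splitAt⁻¹-↑ʳ e)
          adj-copy : ∀ {w'} → E Split (copyᴴ j) w' → Adj (inj₂ j) (splitAt O w')
          adj-copy {w'} rewrite Finₚ.splitAt-↑ʳ O t j = λ a → a
          inside-N : ∀ w' → Adj (inj₂ j) (splitAt O w') → E G v (π w')
          inside-N w' a with splitAt O w'
          ... | inj₁ _ = proj₁ a
          nonempty : ∃[ w' ] Adj (inj₂ j) (splitAt O w')
          nonempty with old-neighbour j _ (here (proj₁ (Leaders.inside-P j)))
          ... | w' , _ , a = w' , adj-copy a
          connected : ∀ w₁ w₂ → Adj (inj₂ j) (splitAt O w₁) → Adj (inj₂ j) (splitAt O w₂) → π w₁ ~ π w₂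
          connected w₁ w₂ a₁ a₂ with splitAt O w₁ | splitAt O w₂
          ... | inj₁ _ | inj₁ _ = reach-trans (~-sym (proj₂ a₁)) (proj₂ a₂)
          closed : ∀ w₁ a → Adj (inj₂ j) (splitAt O w₁) → π w₁ ~ a → ∃[ w₂ ] (π w₂ ≡ a × Adj (inj₂ j) (splitAt O w₂))
          closed w₁ a a₁ w₁~a with splitAt O w₁
          ... | inj₁ _ with old-neighbour j a (reach-trans (proj₂ a₁) w₁~a)
          ... | w₂ , π≡a , a₂ = w₂ , π≡a , adj-copy a₂

      copies-disjoint : ∀ w₁ w₂ w' → π w₁ ≡ v → π w₂ ≡ v → E Split w₁ w' → E Split w₂ w' → w₁ ≡ w₂
      copies-disjoint w₁ w₂ w' ≡v₁ ≡v₂ e₁ e₂ with splitAt O w₁ in q₁ | splitAt O w₂ in q₂ | splitAt O w'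
      ... | inj₁ i | _ | _ = ⊥-elim (Others.outside-¬P i ≡v₁)
      ... | inj₂ _ | inj₁ i | _ = ⊥-elim (Others.outside-¬P i ≡v₂)
      ... | inj₂ j₁ | inj₂ j₂ | inj₁ _ =
        trans (≡-sym (Finₚ.splitAt⁻¹-↑ʳ q₁))
          (trans (cong copyᴴ (Leaders.inside-injective j₁ j₂
                   (leader-unique (Leaders.inside-P j₁) (Leaders.inside-P j₂) (proj₂ e₁) (proj₂ e₂))))
                 (Finₚ.splitAt⁻¹-↑ʳ q₂))

      neighbours-covered : ∀ a → E G v a → ∃[ w ] ∃[ w' ] (π w ≡ v × π w' ≡ a × E Split w w')
      neighbours-covered a va with leader-of a va
      ... | j , j~a with old-neighbour j a j~a
      ... | w' , π≡a , e = copyᴴ j , w' , π-copy j , π≡a , e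

      two-copies : ∃[ w₁ ] ∃[ w₂ ] (π w₁ ≡ v × π w₂ ≡ v × w₁ ≢ w₂)
      two-copies with leader-of x vx | leader-of y vy
      ... | jx , jx~x | jy , jy~y = copyᴴ jx , copyᴴ jy , π-copy jx , π-copy jy , λ eq →
        x≁y (reach-trans (~-sym jx~x) (subst (λ j → leader j ~ y) (≡-sym (Finₚ.↑ʳ-injective O jx jy eq)) jy~y))

exhausted⇒neighbourhood-connected : ∀ {P G k} → Phase1Exhausted P G k → ∀ v →
  (∀ u → Dec (E G v u)) → (∀ x y → Dec (Reach (E G) (E G v) x y)) →
  ∀ {x y} → E G v x → E G v y → Reach (E G) (E G v) x y
exhausted⇒neighbourhood-connected {G = G} {k = k} exhausted v N? _~?_ {x} {y} vx vy with x ~? y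
... | yes x~y = x~y
... | no x≁y = ⊥-elim (exhausted Split k (vertexSplit π v (is-vertex-split vx vy x≁y)))
  where open VertexSplitting G v N? _~?_

↑ˡ≢↑ʳ : ∀ {a b} (i : Fin a) (j : Fin b) → i ↑ˡ b ≢ a ↑ʳ j
↑ˡ≢↑ʳ {a} {b} i j eq
  with trans (≡-sym (Finₚ.splitAt-↑ˡ a i b)) (trans (cong (splitAt a) eq) (Finₚ.splitAt-↑ʳ a b j))
... | ()

-- 2(k+1) independent common neighbours of an edge give the k+1 disjoint non-edges of the Sunflower rule
exhausted⇒no-sunflower : ∀ {P G k} → Phase1Exhausted P G k → 1 ≤ k → ∀ {a b} → E G a b →
  (s : Fin (suc k + suc k) → Fin (n G)) → InjectiveFn s →
  (∀ j → E G a (s j) × E G b (s j)) → (∀ i j → i ≢ j → ¬ E G (s i) (s j)) → ⊥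
exhausted⇒no-sunflower {G = G} {k = suc k} exhausted _ {a} {b} ab s s-inj common independent =
  exhausted (deleteEdge G a b) k (sunflower a b ab (p , q , adjacent , non-edges , p-inj , q-inj , disjoint))
  where
    K : ℕ
    K = suc (suc k)
    p q : Fin K → Fin (n G)
    p i = s (i ↑ˡ K)
    q i = s (K ↑ʳ i)
    adjacent : ∀ i → E G a (p i) × E G b (p i) × E G a (q i) × E G b (q i)
    adjacent i = proj₁ (common (i ↑ˡ K)) , proj₂ (common (i ↑ˡ K)) , proj₁ (common (K ↑ʳ i)) , proj₂ (common (K ↑ʳ i))
    non-edges : ∀ i → p i ≢ q i × ¬ E G (p i) (q i)
    non-edges i = ↑ˡ≢↑ʳ i i ∘ s-inj _ _ , independent _ _ (↑ˡ≢↑ʳ i i)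
    p-inj : InjectiveFn p
    p-inj i j e = Finₚ.↑ˡ-injective K i j (s-inj _ _ e)
    q-inj : InjectiveFn q
    q-inj i j e = Finₚ.↑ʳ-injective K i j (s-inj _ _ e)
    disjoint : ∀ i j → p i ≢ q j
    disjoint i j e = ↑ˡ≢↑ʳ i j (s-inj _ _ e)

phase1-result : ∀ {P G k G₁ k₁} → Phase1 P G k G₁ k₁ → k₁ ≤ k × Phase1Exhausted P G₁ k₁
phase1-result (done exhausted) = ℕ.≤-refl , exhausted
phase1-result (more first rest) with phase1-result rest
... | k₁≤ , exhausted = ℕ.≤-trans k₁≤ (budget-decreases first) , exhausted
  where
    budget-decreases : ∀ {P G k G' k'} → Phase1Step P G k G' k' → k' ≤ k
    budget-decreases (irrelevantEdge _ _ _ _) = ℕ.≤-refl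
    budget-decreases (sunflower _ _ _ _) = ℕ.n≤1+n _
    budget-decreases (vertexSplit _ _ _) = ℕ.≤-refl
    budget-decreases (irrelevantComponent _ _ _ _) = ℕ.≤-refl

record VXTriangle (G : Graph) {P : Problem} (os : List (Occ P (n G))) (s : Fin (n G)) : Set where
  constructor vxTriangle
  field
    x y : Fin (n G)
    x∈VX : VX os x
    y∈VX : VX os y
    sx : E G s x
    sy : E G s y
    xy : E G x y

MaximalPacking : ∀ {P} (G : Graph) → List (Occ P (n G)) → Set
MaximalPacking {P} G os = ¬ (Σ (Occ P (n G)) λ o → InducedOcc (Minus (E G) os) o)

exhausted⇒VXTriangle : ∀ {P G k} {os : List (Occ P (n G))} → ValidProblem P → Phase1Exhausted P G k →
  ∀ s → (∀ u → E G s u → VX os u) → ¬ ¬ VXTriangle G os s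
exhausted⇒VXTriangle {P} {G} valid exhausted s N⊆VX = do
  yes (x , sx) ← ¬¬-excluded-middle {A = ∃[ x ] E G s x}
    where no isolated → λ _ → exhausted⇒no-irrelevant-component exhausted (_≡ s) (_≟ s)
            ( (s , refl) , (λ { u v refl su → ⊥-elim (isolated (v , su)) })
            , (λ { u v refl refl → here refl })
            , λ (o , induced , inside) → occurrence-not-single-vertex valid o induced s inside)
  (o , sub , edge) ← exhausted⇒edge-in-occurrence exhausted sx
  let (y , z , sy , sz , yz) = occurrence-edge-in-triangle valid G o sub edge
  pure (vxTriangle y z (N⊆VX y sy) (N⊆VX z sz) sy sz yz)

∈-index-injective : ∀ {A : Set} {xs : List A} {a b} (p : a ∈ xs) (q : b ∈ xs) → Any.index p ≡ Any.index q → a ≡ b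
∈-index-injective {xs = xs} p q eq = trans (lookup-index p) (trans (cong (lookup xs) eq) (≡-sym (lookup-index q)))

Any⇒nonempty : ∀ {A : Set} {Q : A → Set} {xs} → Any Q xs → 1 ≤ length xs
Any⇒nonempty (here _) = s≤s z≤n
Any⇒nonempty (there _) = s≤s z≤n

-- Isolated vertices in VX-triangles are labelled by the packed edge xy when xy ∈ X, and by the pair (x, y)
-- of V_X vertices otherwise; a label of the first kind is shared by at most 2k+1 of them (Sunflower rule),
-- one of the second kind by at most one (two would form a diamond in G − X).
module IsolatedTriangleCount {P} {G : Graph} {k₁} {os : List (Occ P (n G))}
  (exhausted : Phase1Exhausted P G k₁) (maximal : MaximalPacking G os) (packed : length os ≤ k₁)
  {m} (h : Fin m → Fin (n G)) (h-injective : InjectiveFn h) (h∉VX : ∀ i → ¬ VX os (h i))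
  (independent : ∀ i j → i ≢ j → ¬ E G (h i) (h j)) (triangle : ∀ i → VXTriangle G os (h i)) where

  open module T i = VXTriangle (triangle i)
  open Partition (partition (λ i → InX os (x i) (y i)) (λ i → InX? (x i) (y i)))

  #E #V : ℕ
  #E = length (packedEdges os)
  #V = length (packedVertices os)

  edge-in-X : ∀ j → ∃[ e ] (e ∈ packedEdges os × UEq (x (inside j)) (y (inside j)) (proj₁ e) (proj₂ e))
  edge-in-X j = InX⇒∈packedEdges (inside-P j)

  edge-label : Fin #in → Fin #E
  edge-label j = Any.index (proj₁ (proj₂ (edge-in-X j)))

  vertex-label : ∀ {v} → VX os v → Fin #V
  vertex-label v∈VX = Any.index (VX⇒∈packedVertices v∈VX)

  pair-label : Fin #out → Fin (#V * #V)
  pair-label j = combine (vertex-label (x∈VX (outside j))) (vertex-label (y∈VX (outside j)))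

  h≢VX : ∀ i {v} → VX os v → h i ≢ v
  h≢VX i v∈VX refl = h∉VX i v∈VX

  ∉X : ∀ i {v} → ¬ InX os (h i) v
  ∉X i = h∉VX i ∘ InX⇒VXˡ

  edge-fibres : ∀ c → ¬ AtLeast (suc k₁ + suc k₁) (λ j → edge-label j ≡ c)
  edge-fibres c (g , g-inj , fibre) =
    exhausted⇒no-sunflower exhausted (ℕ.≤-trans (Any⇒nonempty (inside-P (g zero))) packed)
      ab (h ∘ i) (λ _ _ → g-inj _ _ ∘ inside-injective _ _ ∘ h-injective _ _) common
      (λ a b a≢b → independent _ _ (a≢b ∘ g-inj _ _ ∘ inside-injective _ _))
    where
      i : Fin (suc k₁ + suc k₁) → Fin m
      i = inside ∘ g
      a b : Fin (n G)
      a = proj₁ (proj₁ (edge-in-X (g zero)))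
      b = proj₂ (proj₁ (edge-in-X (g zero)))
      same-edge : ∀ l → UEq (x (i l)) (y (i l)) a b
      same-edge l with edge-in-X (g l)
                     | ∈-index-injective (proj₁ (proj₂ (edge-in-X (g l)))) (proj₁ (proj₂ (edge-in-X (g zero))))
                                                         (trans (fibre l) (≡-sym (fibre zero)))
      ... | _ , _ , u | refl = u
      common-neighbour : ∀ {s u v a b} → UEq u v a b → E G s u → E G s v → E G a s × E G b s
      common-neighbour (inj₁ (refl , refl)) su sv = sym G su , sym G sv
      common-neighbour (inj₂ (refl , refl)) su sv = sym G sv , sym G su
      same-edge-adjacent : ∀ {u v a b} → UEq u v a b → E G u v → E G a b
      same-edge-adjacent (inj₁ (refl , refl)) uv = uv
      same-edge-adjacent (inj₂ (refl , refl)) uv = sym G uv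
      common : ∀ l → E G a (h (i l)) × E G b (h (i l))
      common l = common-neighbour (same-edge l) (sx (i l)) (sy (i l))
      ab : E G a b
      ab = same-edge-adjacent (same-edge zero) (xy (i zero))

  pair-fibres : ∀ c → ¬ AtLeast 2 (λ j → pair-label j ≡ c)
  pair-fibres c (g , g-inj , fibre) =
    maximal (dia x₀ y₀ s₀ s₁ , distinct , x₀y₀ , x₀s₀ , x₀s₁ , y₀s₀ , y₀s₁ , ¬s₀s₁)
    where
      i₀ i₁ : Fin m
      i₀ = outside (g zero)
      i₁ = outside (g (suc zero))
      x₀ y₀ s₀ s₁ : Fin (n G)
      x₀ = x i₀
      y₀ = y i₀
      s₀ = h i₀
      s₁ = h i₁
      i₀≢i₁ : i₀ ≢ i₁
      i₀≢i₁ eq with g-inj _ _ (outside-injective _ _ eq)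
      ... | ()
      same-labels : vertex-label (x∈VX i₁) ≡ vertex-label (x∈VX i₀) × vertex-label (y∈VX i₁) ≡ vertex-label (y∈VX i₀)
      same-labels = Finₚ.combine-injective (vertex-label (x∈VX i₁)) (vertex-label (y∈VX i₁))
        (vertex-label (x∈VX i₀)) (vertex-label (y∈VX i₀)) (trans (fibre (suc zero)) (≡-sym (fibre zero)))
      x₁≡x₀ : x i₁ ≡ x₀
      x₁≡x₀ = ∈-index-injective (VX⇒∈packedVertices (x∈VX i₁)) (VX⇒∈packedVertices (x∈VX i₀)) (proj₁ same-labels)
      y₁≡y₀ : y i₁ ≡ y₀
      y₁≡y₀ = ∈-index-injective (VX⇒∈packedVertices (y∈VX i₁)) (VX⇒∈packedVertices (y∈VX i₀)) (proj₂ same-labels)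
      distinct : Distinct4 x₀ y₀ s₀ s₁
      distinct = (λ eq → irrefl G (subst (E G x₀) (≡-sym eq) (xy i₀)))
               , h≢VX i₀ (x∈VX i₀) ∘ ≡-sym , h≢VX i₁ (x∈VX i₀) ∘ ≡-sym
               , h≢VX i₀ (y∈VX i₀) ∘ ≡-sym , h≢VX i₁ (y∈VX i₀) ∘ ≡-sym , i₀≢i₁ ∘ h-injective _ _
      x₀y₀ : Minus (E G) os x₀ y₀
      x₀y₀ = xy i₀ , outside-¬P (g zero)
      x₀s₀ x₀s₁ y₀s₀ y₀s₁ : Minus (E G) os _ _
      x₀s₀ = sym G (sx i₀) , ∉X i₀ ∘ InX-sym
      x₀s₁ = sym G (subst (E G s₁) x₁≡x₀ (sx i₁)) , ∉X i₁ ∘ InX-sym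
      y₀s₀ = sym G (sy i₀) , ∉X i₀ ∘ InX-sym
      y₀s₁ = sym G (subst (E G s₁) y₁≡y₀ (sy i₁)) , ∉X i₁ ∘ InX-sym
      ¬s₀s₁ : ¬ Minus (E G) os s₀ s₁
      ¬s₀s₁ = independent i₀ i₁ i₀≢i₁ ∘ proj₁

  bound : m ≤ #E * (k₁ + suc k₁) + #V * #V * 1
  bound = subst (_≤ #E * (k₁ + suc k₁) + #V * #V * 1) #in+#out
    (ℕ.+-mono-≤ (pigeonhole #E (k₁ + suc k₁) edge-label edge-fibres) (pigeonhole (#V * #V) 1 pair-label pair-fibres))

maximal⇒no-occurrence-with-one-VX : ∀ {P G} {os : List (Occ P (n G))} → MaximalPacking G os →
  (D : Fin (n G) → Set) → (∀ x y → D x → D y → VX os x → VX os y → x ≡ y) →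
  ¬ (Σ (Occ P (n G)) λ o → InducedOcc (E G) o × (∀ v → OccVert o v → D v))
maximal⇒no-occurrence-with-one-VX maximal D ≤one (o , induced , inside) =
  maximal (o , induced-avoids-X o induced λ x y ox oy → ≤one x y (inside x ox) (inside y oy))

-- In a reduced instance every component Z of G − V_X is attached to at least two vertices of V_X: with no
-- attachment Z would be an irrelevant component, and with a single attachment α either Z ∪ {α} is one, or
-- N(α) meets Z and its complement and is disconnected, so the Vertex-split rule would apply to α.
module Attachments {P} {G : Graph} {k} {os : List (Occ P (n G))}
  (exhausted : Phase1Exhausted P G k) (maximal : MaximalPacking G os) (ρ : Fin (n G)) (ρ∉VX : ¬ VX os ρ) where

  Outside : Fin (n G) → Set
  Outside u = ¬ VX os u

  Z : Fin (n G) → Set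
  Z = Reach (E G) Outside ρ

  Attachment : Fin (n G) → Set
  Attachment b = VX os b × ∃[ u ] (Z u × E G u b)

  ρ∈Z : Z ρ
  ρ∈Z = here ρ∉VX

  within-Z : ∀ {x y} → Z x → Reach (E G) Outside x y → Reach (E G) Z x y
  within-Z zx (here _) = here zx
  within-Z zx (step _ e rest) = step zx e (within-Z (reach-snoc zx (reach-start rest) e) rest)

  Z-connected : ∀ u v → Z u → Z v → Reach (E G) Z u v
  Z-connected _ _ zu zv = reach-trans (within-Z zu (reach-sym (sym G) zu)) (within-Z ρ∈Z zv)

  no-attachment : (∀ u → Dec (Z u)) → ¬ ∃ Attachment → ⊥
  no-attachment Z? none = exhausted⇒no-irrelevant-component exhausted Z Z?
    ( (ρ , ρ∈Z) , closed , Z-connected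
    , maximal⇒no-occurrence-with-one-VX {G = G} {os} maximal Z λ x _ zx _ x∈VX _ → ⊥-elim (reach-end zx x∈VX))
    where
      closed : ∀ u v → Z u → E G u v → Z v
      closed u v zu uv with VX? v
      ... | yes v∈VX = ⊥-elim (none (v , v∈VX , u , zu , uv))
      ... | no v∉VX = reach-snoc zu v∉VX uv

  one-attachment : (∀ u → Dec (Z u)) → ∀ {α} → Attachment α → (∀ b → Attachment b → b ≡ α) → ¬ ¬ ⊥
  one-attachment Z? {α} (_ , u₀ , zu₀ , u₀α) unique = do
    N? ← ¬¬-decidable (E G α)
    _~?_ ← ¬¬-decidable₂ (λ x y → Reach (E G) (E G α) x y)
    yes (w , αw , w∉Z) ← ¬¬-excluded-middle {A = ∃[ w ] (E G α w × ¬ Z w)}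
      where no N⊆Z → λ _ → exhausted⇒no-irrelevant-component exhausted D (λ u → Z? u ⊎-dec (u ≟ α))
              ( (ρ , inj₁ ρ∈Z) , closed N⊆Z , connected
              , maximal⇒no-occurrence-with-one-VX {G = G} {os} maximal D λ x y dx dy x∈VX y∈VX →
                  trans (only-α dx x∈VX) (≡-sym (only-α dy y∈VX)))
    λ _ → w∉Z (N-path-stays-in-Z (exhausted⇒neighbourhood-connected exhausted α N? _~?_ (sym G u₀α) αw) zu₀)
    where
      D : Fin (n G) → Set
      D u = Z u ⊎ u ≡ α

      only-α : ∀ {x} → D x → VX os x → x ≡ α
      only-α (inj₁ zx) x∈VX = ⊥-elim (reach-end zx x∈VX)
      only-α (inj₂ x≡α) _ = x≡α

      closed : ¬ (∃[ w ] (E G α w × ¬ Z w)) → ∀ u v → D u → E G u v → D v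
      closed _ u v (inj₁ zu) uv with VX? v
      ... | yes v∈VX = inj₂ (unique v (v∈VX , u , zu , uv))
      ... | no v∉VX = inj₁ (reach-snoc zu v∉VX uv)
      closed N⊆Z u v (inj₂ refl) uv with Z? v
      ... | yes zv = inj₁ zv
      ... | no v∉Z = ⊥-elim (N⊆Z (v , uv , v∉Z))

      α-to-ρ : Reach (E G) D α ρ
      α-to-ρ = reach-trans (step (inj₂ refl) (sym G u₀α) (here (inj₁ zu₀)))
                           (reach-mono (λ _ → inj₁) (Z-connected u₀ ρ zu₀ ρ∈Z))

      connected : ∀ u v → D u → D v → Reach (E G) D u v
      connected u v (inj₁ zu) (inj₁ zv) = reach-mono (λ _ → inj₁) (Z-connected u v zu zv)
      connected u v (inj₁ zu) (inj₂ refl) =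
        reach-trans (reach-mono (λ _ → inj₁) (Z-connected u ρ zu ρ∈Z)) (reach-sym (sym G) α-to-ρ)
      connected u v (inj₂ refl) (inj₁ zv) = reach-trans α-to-ρ (reach-mono (λ _ → inj₁) (Z-connected ρ v ρ∈Z zv))
      connected u v (inj₂ refl) (inj₂ refl) = here (inj₂ refl)

      N-path-stays-in-Z : ∀ {x y} → Reach (E G) (E G α) x y → Z x → Z y
      N-path-stays-in-Z (here _) zx = zx
      N-path-stays-in-Z (step {_} {x₁} _ e rest) zx with VX? x₁
      ... | yes x₁∈VX = ⊥-elim (irrefl G (subst (E G α) (unique x₁ (x₁∈VX , _ , zx , e)) (reach-start rest)))
      ... | no x₁∉VX = N-path-stays-in-Z rest (reach-snoc zx x₁∉VX e)

  two-attachments : ¬ ¬ (∃₂ λ b₁ b₂ → b₁ ≢ b₂ × Attachment b₁ × Attachment b₂)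
  two-attachments = do
    Z? ← ¬¬-decidable Z
    yes (b₁ , att₁) ← ¬¬-excluded-middle {A = ∃ Attachment}
      where no none → λ _ → no-attachment Z? none
    yes (b₂ , att₂ , b₂≢b₁) ← ¬¬-excluded-middle {A = ∃[ b ] (Attachment b × b ≢ b₁)}
      where no only-b₁ → λ _ → one-attachment Z? att₁
              (λ b att → decidable-stable (b ≟ b₁) (λ b≢b₁ → only-b₁ (b , att , b≢b₁))) (λ ())
    pure (b₁ , b₂ , b₂≢b₁ ∘ ≡-sym , att₁ , att₂)

module CliqueReduction {P} (valid : ValidProblem P) {G : Graph} {k₁} {os : List (Occ P (n G))}
  (exhausted : Phase1Exhausted P G k₁) (maximal : MaximalPacking G os) where

  Outside : Fin (n G) → Set
  Outside u = ¬ VX os u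

  -- H and W are the graph and the image of V_X after some clique reductions of the Phase 1 output G.
  record Tracking (H : Graph) (W : Fin (n H) → Set) : Set where
    field
      ι : Fin (n H) → Fin (n G)
      ι-injective : InjectiveFn ι
      ι-edge : ∀ i j → E H i j → E G (ι i) (ι j)
      ι-edge⁻ : ∀ i j → E G (ι i) (ι j) → E H i j
      VX⇒W : ∀ j → VX os (ι j) → W j
      VX-kept : ∀ u → VX os u → ∃[ j ] ι j ≡ u
      outside-connected : ∀ j j' → Reach (E G) Outside (ι j) (ι j') → Reach (E H) (¬_ ∘ W) j j'
      attachment : ∀ u b → Outside u → VX os b → E G u b →
        ∃[ j ] (¬ W j × Reach (E G) Outside (ι j) u × E G (ι j) b)
      isolated-triangle : ∀ j → ¬ W j → (∀ j' → ¬ W j' → ¬ E H j j') → ¬ ¬ VXTriangle G os (ι j)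

  initial : Tracking G (VX os)
  initial = record
    { ι = λ x → x ; ι-injective = λ _ _ e → e ; ι-edge = λ _ _ e → e ; ι-edge⁻ = λ _ _ e → e
    ; VX⇒W = λ _ w → w ; VX-kept = λ u _ → u , refl
    ; outside-connected = λ _ _ p → p
    ; attachment = λ u _ u∉VX _ ub → u , u∉VX , here u∉VX , ub
    ; isolated-triangle = λ j j∉VX isolated → exhausted⇒VXTriangle valid exhausted j (neighbour-in-VX isolated) }
    where
      neighbour-in-VX : ∀ {j} → (∀ j' → ¬ VX os j' → ¬ E G j j') → ∀ u → E G j u → VX os u
      neighbour-in-VX isolated u ju with VX? u
      ... | yes u∈VX = u∈VX
      ... | no u∉VX = ⊥-elim (isolated u u∉VX ju)

  module Step {H : Graph} {W : Fin (n H) → Set} {H' : Graph}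
    (C : Fin (n H) → Set) (r r₂ : Fin (n H)) (f : Fin (n H') → Fin (n H))
    (C∩W=∅ : ∀ v → C v → ¬ W v) (C-clique : ∀ u v → C u → C v → u ≢ v → E H u v)
    (r∈C'' : C'' H W C r) (r₂∈C'' : C'' H W C r₂) (r≢r₂ : r ≢ r₂)
    (f-injective : InjectiveFn f) (f-onto : ∀ v → (¬ C'' H W C v ⊎ v ≡ r) → ∃[ i ] f i ≡ v)
    (f-edge : ∀ i j → E H' i j → E H (f i) (f j)) (f-edge⁻ : ∀ i j → E H (f i) (f j) → E H' i j)
    (C''? : ∀ x → Dec (C'' H W C x)) (tracking : Tracking H W) where
    open Tracking tracking

    NW : Fin (n H) → Set
    NW x = ¬ W x
    NW' : Fin (n H') → Set
    NW' i = ¬ W (f i)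

    Surviving Deleted : Fin (n H) → Set
    Surviving x = ¬ C'' H W C x ⊎ x ≡ r
    Deleted x = C'' H W C x × x ≢ r

    fate : ∀ x → Surviving x ⊎ Deleted x
    fate x with C''? x | x ≟ r
    ... | no x∉C'' | _ = inj₁ (inj₁ x∉C'')
    ... | yes _ | yes x≡r = inj₁ (inj₂ x≡r)
    ... | yes x∈C'' | no x≢r = inj₂ (x∈C'' , x≢r)

    r∈C : C r
    r∈C = proj₁ r∈C''
    r₂∈C : C r₂
    r₂∈C = proj₁ r₂∈C''

    C⇒outside : ∀ {c} → C c → Outside (ι c)
    C⇒outside {c} c∈C c∈VX = C∩W=∅ c c∈C (VX⇒W c c∈VX)

    C''-step : ∀ {x y} → C'' H W C x → E H x y → NW y → C y
    C''-step (_ , closed) xy y∉W with closed _ xy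
    ... | inj₁ y∈C = y∈C
    ... | inj₂ (y∈W , _) = ⊥-elim (y∉W y∈W)

    r-survives : ∃[ i ] f i ≡ r
    r-survives = f-onto r (inj₂ refl)

    FromC : Fin (n H') → Set
    FromC i₂ = ∃[ i₀ ] (C (f i₀) × Reach (E H') NW' i₀ i₂)

    -- A path of H − W between surviving vertices survives, because its deleted stretches lie in the clique C
    -- and can be short-cut through a surviving vertex of C.
    continue-path : ∀ i₁ {x₁ i₂} → NW (f i₁) → E H (f i₁) x₁ → Surviving x₁ ⊎ Deleted x₁ →
      (∀ i → f i ≡ x₁ → Reach (E H') NW' i i₂) → (C x₁ → FromC i₂) → Reach (E H') NW' i₁ i₂
    continue-path i₁ i₁∉W e (inj₁ survives) rest _ with f-onto _ survives
    ... | i , refl = step i₁∉W (f-edge⁻ i₁ i e) (rest i refl)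
    continue-path i₁ i₁∉W e (inj₂ (x₁∈C'' , _)) _ from-C with from-C (proj₁ x₁∈C'')
    ... | i₀ , i₀∈C , p with i₁ ≟ i₀
    ...   | yes refl = p
    ...   | no i₁≢i₀ = step i₁∉W (f-edge⁻ i₁ i₀ (C-clique _ _ (C''-step x₁∈C'' (sym H e) i₁∉W) i₀∈C
                                                 (i₁≢i₀ ∘ f-injective _ _))) p

    continue-from-C : ∀ {x x₁ i₂} → C x → E H x x₁ → NW x₁ → Surviving x ⊎ Deleted x →
      (∀ i₁ → f i₁ ≡ x → Reach (E H') NW' i₁ i₂) → (C x₁ → FromC i₂) → FromC i₂
    continue-from-C x∈C _ _ (inj₁ survives) path _ with f-onto _ survives
    ... | i₁ , refl = i₁ , x∈C , path i₁ refl
    continue-from-C _ e x₁∉W (inj₂ (x∈C'' , _)) _ from-C = from-C (C''-step x∈C'' e x₁∉W)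

    path-survives : ∀ {x y} → Reach (E H) NW x y → ∀ i₁ i₂ → f i₁ ≡ x → f i₂ ≡ y → Reach (E H') NW' i₁ i₂
    path-from-C-survives : ∀ {x y} → Reach (E H) NW x y → C x → ∀ i₂ → f i₂ ≡ y → FromC i₂
    path-survives (here x∉W) i₁ i₂ refl eq = subst (Reach (E H') NW' i₁) (f-injective i₁ i₂ (≡-sym eq)) (here x∉W)
    path-survives (step {_} {x₁} x∉W e rest) i₁ i₂ refl eq =
      continue-path i₁ x∉W e (fate x₁) (λ i p → path-survives rest i i₂ p eq)
        (λ x₁∈C → path-from-C-survives rest x₁∈C i₂ eq)
    path-from-C-survives (here x∉W) x∈C i₂ refl = i₂ , x∈C , here x∉W
    path-from-C-survives (step {x} x∉W e rest) x∈C i₂ eq =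
      continue-from-C x∈C e (reach-start rest) (fate x)
        (λ i₁ p → path-survives (step x∉W e rest) i₁ i₂ p eq) (λ x₁∈C → path-from-C-survives rest x₁∈C i₂ eq)

    VX-kept' : ∀ u → VX os u → ∃[ i ] ι (f i) ≡ u
    VX-kept' u u∈VX with VX-kept u u∈VX
    ... | j , refl with fate j
    ...   | inj₂ (j∈C'' , _) = ⊥-elim (C⇒outside (proj₁ j∈C'') u∈VX)
    ...   | inj₁ survives with f-onto j survives
    ...     | i , refl = i , refl

    attachment' : ∀ u b → Outside u → VX os b → E G u b →
      ∃[ i ] (NW' i × Reach (E G) Outside (ι (f i)) u × E G (ι (f i)) b)
    attachment' u b u∉VX b∈VX ub with attachment u b u∉VX b∈VX ub
    ... | j , j∉W , ju , jb with fate j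
    ...   | inj₁ survives with f-onto j survives
    ...     | i , refl = i , j∉W , ju , jb
    attachment' u b u∉VX b∈VX ub | j , j∉W , ju , jb | inj₂ (j∈C'' , j≢r) with VX-kept b b∈VX
    ... | b′ , refl with proj₂ j∈C'' b′ (ι-edge⁻ j b′ jb) | r-survives
    ...   | inj₁ b′∈C | _ = ⊥-elim (C⇒outside b′∈C b∈VX)
    ...   | inj₂ (_ , b′-to-C) | ir , refl =
      ir , C∩W=∅ r r∈C , step (C⇒outside r∈C) (ι-edge r j (C-clique r j r∈C (proj₁ j∈C'') (j≢r ∘ ≡-sym))) ju ,
      ι-edge r b′ (sym H (b′-to-C r r∈C))

    module IsolatedR (i : Fin (n H')) (fi≡r : f i ≡ r) (isolated : ∀ i' → NW' i' → ¬ E H' i i') where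
      open Attachments exhausted maximal (ι r) (C⇒outside r∈C)

      C⊆C'' : ∀ c → C c → C'' H W C c
      C⊆C'' c c∈C with C''? c | c ≟ r
      ... | yes c∈C'' | _ = c∈C''
      ... | no _ | yes refl = r∈C''
      ... | no c∉C'' | no c≢r with f-onto c (inj₁ c∉C'')
      ...   | ic , refl = ⊥-elim (isolated ic (C∩W=∅ _ c∈C)
                             (f-edge⁻ i ic (subst (λ x → E H x (f ic)) (≡-sym fi≡r) (C-clique r _ r∈C c∈C (c≢r ∘ ≡-sym)))))

      C-closed : ∀ {x y} → C x → Reach (E H) NW x y → C y
      C-closed x∈C (here _) = x∈C
      C-closed x∈C (step _ e rest) = C-closed (C''-step (C⊆C'' _ x∈C) e (reach-start rest)) rest

      attachment-adjacent-to-C : ∀ {b} → Attachment b → ∀ c → C c → E G (ι c) b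
      attachment-adjacent-to-C {b} (b∈VX , u , zu , ub) c c∈C with attachment u b (reach-end zu) b∈VX ub
      ... | j , _ , ju , jb with VX-kept b b∈VX
      ... | b′ , refl with proj₂ (C⊆C'' j (C-closed r∈C (outside-connected r j (reach-trans zu (reach-sym (sym G) ju)))))
                               b′ (ι-edge⁻ j b′ jb)
      ...   | inj₁ b′∈C = ⊥-elim (C⇒outside b′∈C b∈VX)
      ...   | inj₂ (_ , b′-to-C) = ι-edge c b′ (sym H (b′-to-C c c∈C))

      -- two attachments of the component C of r are adjacent to both r and r₂, so they either
      -- close a VX-triangle with r or form a diamond r r₂ b₁ b₂ avoiding X
      r-triangle : ¬ ¬ VXTriangle G os (ι r)
      r-triangle = do
        (b₁ , b₂ , b₁≢b₂ , att₁@(b₁∈VX , _) , att₂@(b₂∈VX , _)) ← two-attachments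
        let rb₁ = attachment-adjacent-to-C att₁ r r∈C
            rb₂ = attachment-adjacent-to-C att₂ r r∈C
            r₂b₁ = attachment-adjacent-to-C att₁ r₂ r₂∈C
            r₂b₂ = attachment-adjacent-to-C att₂ r₂ r₂∈C
            outside≢VX : ∀ {c} → C c → ∀ {b} → VX os b → ι c ≢ b
            outside≢VX c∈C b∈VX eq = C⇒outside c∈C (subst (VX os) (≡-sym eq) b∈VX)
        yes b₁b₂ ← ¬¬-excluded-middle {A = E G b₁ b₂}
          where no ¬b₁b₂ → λ _ → maximal
                  ( dia (ι r) (ι r₂) b₁ b₂
                  , ( r≢r₂ ∘ ι-injective _ _ , outside≢VX r∈C b₁∈VX , outside≢VX r∈C b₂∈VX
                    , outside≢VX r₂∈C b₁∈VX , outside≢VX r₂∈C b₂∈VX , b₁≢b₂ )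
                  , (ι-edge r r₂ (C-clique r r₂ r∈C r₂∈C r≢r₂) , C⇒outside r∈C ∘ InX⇒VXˡ)
                  , (rb₁ , C⇒outside r∈C ∘ InX⇒VXˡ) , (rb₂ , C⇒outside r∈C ∘ InX⇒VXˡ)
                  , (r₂b₁ , C⇒outside r₂∈C ∘ InX⇒VXˡ) , (r₂b₂ , C⇒outside r₂∈C ∘ InX⇒VXˡ)
                  , ¬b₁b₂ ∘ proj₁ )
        pure (vxTriangle b₁ b₂ b₁∈VX b₂∈VX rb₁ rb₂ b₁b₂)

    isolated-triangle' : ∀ i → NW' i → (∀ i' → NW' i' → ¬ E H' i i') → ¬ ¬ VXTriangle G os (ι (f i))
    isolated-triangle' i i∉W isolated = ¬¬-excluded-middle >>= λ where
        (no none) → isolated-triangle (f i) i∉W (λ y y∉W iy → none (y , y∉W , iy))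
        (yes (y , y∉W , iy)) → neighbour-deleted y y∉W iy (fate y)
      where
        neighbour-deleted : ∀ y → NW y → E H (f i) y → Surviving y ⊎ Deleted y → ¬ ¬ VXTriangle G os (ι (f i))
        neighbour-deleted y y∉W iy (inj₁ survives) with f-onto y survives
        ... | i' , refl = λ _ → isolated i' y∉W (f-edge⁻ i i' iy)
        neighbour-deleted y y∉W iy (inj₂ (y∈C'' , _)) with f i ≟ r | r-survives
        ... | yes fi≡r | _ = subst (λ x → ¬ ¬ VXTriangle G os (ι x)) (≡-sym fi≡r) (IsolatedR.r-triangle i fi≡r isolated)
        ... | no fi≢r | ir , refl = λ _ → isolated ir (C∩W=∅ _ r∈C)
                                     (f-edge⁻ i ir (C-clique _ _ (C''-step y∈C'' (sym H iy) i∉W) r∈C fi≢r))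

    tracking' : Tracking H' (λ i → W (f i))
    tracking' = record
      { ι = ι ∘ f ; ι-injective = λ i j e → f-injective i j (ι-injective _ _ e)
      ; ι-edge = λ i j e → ι-edge _ _ (f-edge i j e) ; ι-edge⁻ = λ i j e → f-edge⁻ i j (ι-edge⁻ _ _ e)
      ; VX⇒W = VX⇒W ∘ f ; VX-kept = VX-kept'
      ; outside-connected = λ i i' p → path-survives (outside-connected (f i) (f i') p) i i' refl refl
      ; attachment = attachment' ; isolated-triangle = isolated-triangle' }

  step-preserves : ∀ {k' H W H' W'} → CliqueStep k' H W H' W' → Tracking H W → ¬ ¬ Tracking H' W'
  step-preserves {H = H} {W}
    (reduce C r r₂ f ((C∩W=∅ , C-clique) , _) _ _ r∈C'' r₂∈C'' r≢r₂ (f-injective , _ , f-onto , f-edge , f-edge⁻))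
    tracking = do
    C''? ← ¬¬-decidable (C'' H W C)
    pure (Step.tracking' C r r₂ f C∩W=∅ C-clique r∈C'' r₂∈C'' r≢r₂ f-injective f-onto f-edge f-edge⁻ C''? tracking)

  run-preserves : ∀ {k' H W H' W'} → CliqueRun k' H W H' W' → Tracking H W → ¬ ¬ Tracking H' W'
  run-preserves (done _) tracking = pure tracking
  run-preserves (more first rest) tracking = step-preserves first tracking >>= run-preserves rest

singleton-clique-isolated : ∀ {H W v} → IsMaxCliqueOut H W (λ u → u ≡ v) → ¬ W v × (∀ u → ¬ W u → ¬ E H v u)
singleton-clique-isolated {H} {v = v} ((outside , _) , maximal) =
  outside v refl , λ u u∉W vu → irrefl H (subst (E H v) (maximal u u∉W λ { _ refl _ → sym H vu }) vu)

quadratic-bound : ∀ e {k₁ k #E #V} → k₁ ≤ k → #E ≤ k * e → #V ≤ #E * 2 →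
  #E * (k₁ + suc k₁) + #V * #V * 1 ≤ (4 * e * e + 3 * e) * k * k + (4 * e * e + 3 * e)
quadratic-bound e {k₁} {k} {#E} {#V} k₁≤k #E≤ #V≤ = begin
  #E * (k₁ + suc k₁) + #V * #V * 1
    ≤⟨ ℕ.+-mono-≤ (ℕ.*-mono-≤ #E≤ (ℕ.+-mono-≤ k₁≤k (s≤s k₁≤k)))
                  (ℕ.*-mono-≤ (ℕ.*-mono-≤ #V≤′ #V≤′) ℕ.≤-refl) ⟩
  k * e * (k + suc k) + k * e * 2 * (k * e * 2) * 1
    ≡⟨ solve 2 (λ k e → k :* e :* (k :+ (con 1 :+ k)) :+ k :* e :* con 2 :* (k :* e :* con 2) :* con 1
                     := e :* (con 2 :* (k :* k) :+ k) :+ con 4 :* e :* e :* (k :* k)) refl k e ⟩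
  e * (2 * (k * k) + k) + 4 * e * e * (k * k)
    ≤⟨ ℕ.+-monoˡ-≤ (4 * e * e * (k * k)) (ℕ.*-monoʳ-≤ e (ℕ.+-monoʳ-≤ (2 * (k * k)) (n≤n*n k))) ⟩
  e * (2 * (k * k) + k * k) + 4 * e * e * (k * k)
    ≡⟨ solve 2 (λ k e → e :* (con 2 :* (k :* k) :+ k :* k) :+ con 4 :* e :* e :* (k :* k)
                     := (con 4 :* e :* e :+ con 3 :* e) :* k :* k) refl k e ⟩
  (4 * e * e + 3 * e) * k * k
    ≤⟨ ℕ.m≤m+n _ _ ⟩
  (4 * e * e + 3 * e) * k * k + (4 * e * e + 3 * e) ∎
  where
    open ℕ.≤-Reasoning
    open +-*-Solver using (solve; _:*_; _:+_; _:=_; con)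
    #V≤′ : #V ≤ k * e * 2
    #V≤′ = ℕ.≤-trans #V≤ (ℕ.*-monoˡ-≤ 2 #E≤)
    n≤n*n : ∀ n → n ≤ n * n
    n≤n*n zero = z≤n
    n≤n*n (suc n) = ℕ.m≤m+n (suc n) (n * suc n)

singletonConstant : Problem → ℕ
singletonConstant P = 4 * edgeBound P * edgeBound P + 3 * edgeBound P

SingletonCliquesAtMost : (H : Graph) → (Fin (n H) → Set) → ℕ → Set
SingletonCliquesAtMost H W b =
  (m : ℕ) (g : Fin m → Fin (n H)) → InjectiveFn g → (∀ i → IsMaxCliqueOut H W (λ u → u ≡ g i)) → m ≤ b

module SingletonBound {P} (valid : ValidProblem P) {G k G₁ k₁} {os : List (Occ P (n G₁))}
  (phase1 : Phase1 P G k G₁ k₁) (packing : GreedyPacking (E G₁) os) (packed : length os ≤ k₁) where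

  k₁≤k : k₁ ≤ k
  k₁≤k = proj₁ (phase1-result phase1)
  exhausted : Phase1Exhausted P G₁ k₁
  exhausted = proj₂ (phase1-result phase1)
  open CliqueReduction valid exhausted (proj₂ packing)

  tracked : ∀ {H W} → ¬ ¬ Tracking H W → SingletonCliquesAtMost H W (singletonConstant P * k * k + singletonConstant P)
  tracked {H} {W} ¬¬tracking m g g-injective singleton = decidable-stable (m ≤? _) (¬¬tracking >>= count)
    where
      isolated : ∀ i → ¬ W (g i) × (∀ u → ¬ W u → ¬ E H (g i) u)
      isolated i = singleton-clique-isolated {H} {W} {g i} (singleton i)
      count : Tracking H W → ¬ ¬ (m ≤ singletonConstant P * k * k + singletonConstant P)
      count tracking = do
          triangles ← ¬¬-Π-Fin λ i → isolated-triangle (g i) (proj₁ (isolated i)) (proj₂ (isolated i))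
          pure (ℕ.≤-trans
            (IsolatedTriangleCount.bound {os = os} exhausted (proj₂ packing) packed (ι ∘ g)
              (λ i j → g-injective i j ∘ ι-injective _ _) (λ i → proj₁ (isolated i) ∘ VX⇒W (g i))
              (λ i j i≢j → proj₂ (isolated i) (g j) (proj₁ (isolated j)) ∘ ι-edge⁻ (g i) (g j)) triangles)
            (quadratic-bound (edgeBound P) k₁≤k
              (ℕ.≤-trans (length-packedEdges {os = os}) (ℕ.*-monoˡ-≤ (edgeBound P) (ℕ.≤-trans packed k₁≤k)))
              (length-packedVertices {os = os})))
        where open Tracking tracking

  after-clique-reduction : ∀ {H W} → CliqueRun k₁ G₁ (VX os) H W →
    SingletonCliquesAtMost H W (singletonConstant P * k * k + singletonConstant P)
  after-clique-reduction run = tracked (run-preserves run initial)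

  without-clique-reduction : SingletonCliquesAtMost G₁ (VX os) (singletonConstant P * k * k + singletonConstant P)
  without-clique-reduction = tracked (pure initial)

kernel-singleton-cliques : ∀ {P} → ValidProblem P → ∀ {G k H W} → Kernel P G k H W →
  SingletonCliquesAtMost H W (singletonConstant P * k * k + singletonConstant P)
kernel-singleton-cliques valid (kernelDiamond _ phase1 packing packed run) =
  SingletonBound.after-clique-reduction valid phase1 packing packed run
kernel-singleton-cliques valid (kernelDiamondK _ phase1 packing packed) =
  SingletonBound.without-clique-reduction valid phase1 packing packed

lemma14 : (P : Problem) → ValidProblem P →
    Σ ℕ λ c → (G : Graph) (k : ℕ) (H : Graph) (W : Fin (n H) → Set) →
      Kernel P G k H W →
      (m : ℕ) (g : Fin m → Fin (n H)) → InjectiveFn g →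
      (∀ i → IsMaxCliqueOut H W (λ u → u ≡ g i)) →
      m ≤ c * k * k + c
lemma14 P valid = singletonConstant P , λ G k H W → kernel-singleton-cliques valid
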